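{- Let $G_0=(V,E_0)$ be a $(k-1)$-edge-connected graph with $k\ge2$, $Q\subseteq V$, and ${\cal T}$ the family of tight bisets. Fix some ${\cal T}$-core $\mathbb{C}_0=(C_0,C_0^+)$ and a node $s\in C_0$, and let ${\cal F}=\{\mathbb{A}\in{\cal T}: s\in A^*\}$. Then ${\cal F}$ is an intersecting biset family, and an edge set $J$ on $V$ is such that $G_0\cup J$ is $k$-edge-connected and has no cut-node in $Q$ if and only if $J$ covers ${\cal F}$.
   Context: A biset on $V$ is a pair $\mathbb{A}=(A,A^+)$ with $A\subseteq A^+\subseteq V$; $\partial\mathbb{A}=A^+\setminus A$, $A^*=V\setminus A^+$; $\mathbb{A}$ is proper if $A\ne\emptyset\ne A^*$. $\mathbb{A}\cap\mathbb{B}=(A\cap B,A^+\cap B^+)$, $\mathbb{A}\cup\mathbb{B}=(A\cup B,A^+\cup B^+)$, $\mathbb{A}\subseteq\mathbb{B}$ means $A\subseteq B$ and $A^+\subseteq B^+$. A biset family is intersecting if it contains $\mathbb{A}\cap\mathbb{B}$ and $\mathbb{A}\cup\mathbb{B}$ whenever it contains $\mathbb{A},\mathbb{B}$ with $A\cap B\neq\emptyset$. $d_{G_0}(\mathbb{A})$ is the number of edges of $G_0$ with one end in $A$ and the other in $A^*$. Node capacities: $q(v)=k-1$ if $v\in Q$, $q(v)=\infty$ otherwise, $q(S)=\sum_{v\in S}q(v)$. A proper biset $\mathbb{A}$ is tight if $d_{G_0}(\mathbb{A})+q(\partial\mathbb{A})=k-1$. A ${\cal T}$-core is an inclusion-minimal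 member of ${\cal T}$. An edge covers $\mathbb{A}$ if it has one endnode in $A$ and the other in $A^*$; $J$ covers ${\cal F}$ if each member is covered by an edge of $J$. A cut-node of a graph is a node whose removal disconnects it. -}

module Defs where

open import Data.Nat using (ℕ; zero; suc; _+_; _*_; _∸_; _≤_)
open import Data.Bool using (Bool; true; false; if_then_else_)
open import Data.Fin using (Fin)
open import Data.Fin.Subset using (Subset; _∈_; _∉_; _⊆_; _∩_; _∪_; ∁; _─_; Nonempty)
open import Data.Fin.Subset.Properties using (_∈?_)
open import Data.Vec using (lookup)
open import Data.List using (List; length; filter; foldr; allFin; _++_)
open import Data.List.Relation.Unary.Any using (Any)
open import Data.Product using (_×_; _,_; ∃; proj₁; proj₂)
open import Data.Sum using (_⊎_)
open import Relation.Nullary using (¬_; Dec)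
open import Relation.Nullary.Decidable using (_×-dec_; _⊎-dec_; ¬?)
open import Relation.Binary.PropositionalEquality using (_≡_; _≢_)

-- Node set V = Fin n.  An edge is an (unordered, read symmetrically) pair of
-- nodes; a (multi)graph on V is a list of edges (parallel edges allowed).
Edge : ℕ → Set
Edge n = Fin n × Fin n

Graph : ℕ → Set
Graph n = List (Edge n)

-- A biset is a pair (A , A⁺) with A ⊆ A⁺ (the inclusion is part of `IsBiset`).
Biset : ℕ → Set
Biset n = Subset n × Subset n

module _ {n : ℕ} where

  inner : Biset n → Subset n
  inner = proj₁

  outer : Biset n → Subset n
  outer = proj₂

  IsBiset : Biset n → Set
  IsBiset 𝔸 = inner 𝔸 ⊆ outer 𝔸

  ∂ : Biset n → Subset n
  ∂ 𝔸 = outer 𝔸 ─ inner 𝔸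

  star : Biset n → Subset n
  star 𝔸 = ∁ (outer 𝔸)

  _∩ᵇ_ : Biset n → Biset n → Biset n
  (A , A⁺) ∩ᵇ (B , B⁺) = (A ∩ B , A⁺ ∩ B⁺)

  _∪ᵇ_ : Biset n → Biset n → Biset n
  (A , A⁺) ∪ᵇ (B , B⁺) = (A ∪ B , A⁺ ∪ B⁺)

  _⊆ᵇ_ : Biset n → Biset n → Set
  𝔸 ⊆ᵇ 𝔹 = (inner 𝔸 ⊆ inner 𝔹) × (outer 𝔸 ⊆ outer 𝔹)

  Proper : Biset n → Set
  Proper 𝔸 = IsBiset 𝔸 × Nonempty (inner 𝔸) × Nonempty (star 𝔸)

  Covers : Edge n → Biset n → Set
  Covers (u , v) 𝔸 = (u ∈ inner 𝔸 × v ∈ star 𝔸) ⊎ (v ∈ inner 𝔸 × u ∈ star 𝔸)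

  covers? : (e : Edge n) (𝔸 : Biset n) → Dec (Covers e 𝔸)
  covers? (u , v) 𝔸 =
    ((u ∈? inner 𝔸) ×-dec (v ∈? star 𝔸)) ⊎-dec ((v ∈? inner 𝔸) ×-dec (u ∈? star 𝔸))

  deg : Graph n → Biset n → ℕ
  deg G 𝔸 = length (filter (λ e → covers? e 𝔸) G)

  CoversFamily : Graph n → (Biset n → Set) → Set
  CoversFamily J ℱ = ∀ 𝔸 → ℱ 𝔸 → Any (λ e → Covers e 𝔸) J

  Intersecting : (Biset n → Set) → Set
  Intersecting ℱ = ∀ 𝔸 𝔹 → ℱ 𝔸 → ℱ 𝔹 → Nonempty (inner 𝔸 ∩ inner 𝔹) →
                   ℱ (𝔸 ∩ᵇ 𝔹) × ℱ (𝔸 ∪ᵇ 𝔹)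

  EdgeConnected : ℕ → Graph n → Set
  EdgeConnected ℓ G = ∀ (S : Subset n) → Nonempty S → Nonempty (∁ S) → ℓ ≤ deg G (S , S)

  data ReachAvoid (G : Graph n) (w : Fin n) (x : Fin n) : Fin n → Set where
    here : ReachAvoid G w x x
    step : ∀ {y a b} → ReachAvoid G w x y → Any (λ e → e ≡ (a , b) ⊎ e ≡ (b , a)) G →
           y ≡ a → b ≢ w → ReachAvoid G w x b

  CutNode : Graph n → Fin n → Set
  CutNode G w = ∃ λ x → ∃ λ y → x ≢ w × y ≢ w × ¬ ReachAvoid G w x y

data ℕ∞ : Set where
  fin : ℕ → ℕ∞
  ∞   : ℕ∞

_+∞_ : ℕ∞ → ℕ∞ → ℕ∞
fin a +∞ fin b = fin (a + b)
fin _ +∞ ∞     = ∞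
∞     +∞ _     = ∞

module _ {n : ℕ} where
  q : ℕ → Subset n → Fin n → ℕ∞
  q k Q v = if lookup Q v then fin (k ∸ 1) else ∞

  qSum : ℕ → Subset n → Subset n → ℕ∞
  qSum k Q S = foldr (λ v acc → if lookup S v then q k Q v +∞ acc else acc) (fin 0) (allFin n)

  Tight : ℕ → Graph n → Subset n → Biset n → Set
  Tight k G₀ Q 𝔸 = Proper 𝔸 × (fin (deg G₀ 𝔸) +∞ qSum k Q (∂ 𝔸) ≡ fin (k ∸ 1))

  Core : (Biset n → Set) → Biset n → Set
  Core 𝒯 ℂ = 𝒯 ℂ × (∀ 𝔸 → 𝒯 𝔸 → 𝔸 ⊆ᵇ ℂ → 𝔸 ≡ ℂ)

{-# OPTIONS --safe #-}
-- Write cap 𝔸 = d(𝔸) + q(∂𝔸). Since G₀ is (k-1)-edge-connected, every proper biset has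
-- cap ≥ k-1, and cap is submodular (edge by edge and node by node); so two tight bisets
-- sharing an inner node uncross into tight bisets, and ℱ is intersecting.
-- A tight biset either has empty boundary, and then it is a cut of G₀ of size k-1, or it has a
-- single boundary node v ∈ Q and no G₀-edge crossing it, and then v separates A from A* in G₀.
-- Hence G₀ ∪ J is k-edge-connected without cut nodes in Q iff J covers every tight biset.
-- Covering ℱ already suffices: a tight 𝔸 with s ∈ A is covered through its co-biset
-- (A*, V ∖ A) ∈ ℱ, and s is never a boundary node. Indeed, if ∂𝔸 = {s} ⊆ C₀ then the pieces
-- A ∖ C₀ and A* ∖ C₀ are nonempty by minimality of ℂ₀, and every G₀-edge leaving one of them
-- crosses ℂ₀; this contradicts d(ℂ₀) = k-1 when ∂ℂ₀ = ∅ and d(ℂ₀) = 0 otherwise.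
module Submission where

open import Defs
open import Algebra.Bundles using (CommutativeSemigroup)
open import Data.Bool using (Bool; true; false; not; _∧_; _∨_; if_then_else_; T)
open import Data.Bool.Properties using (∧-zeroʳ; ∧-identityʳ; ∧-comm; not-involutive)
open import Data.Fin using (Fin; zero; suc)
import Data.Fin.Properties as Fin
open import Data.Fin.Subset using (Subset; _∈_; _∉_; _⊆_; _∩_; _∪_; ∁; _─_; Nonempty; ⁅_⁆; ∣_∣)
open import Data.Fin.Subset.Properties
  using (_∈?_; nonempty?; ⊆-antisym; ⊆-reflexive; x∈⁅x⁆; x≢y⇒x∉⁅y⁆; x∈⁅y⁆⇒x≡y;
         x∈∁p⇒x∉p; x∉p⇒x∈∁p; p⊆q⇒∁p⊇∁q; x∈p∩q⁺; x∈p∩q⁻; x∈p∪q⁻; p⊆p∪q; q⊆p∪q;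
         p─q⊆p; x∈p∧x∉q⇒x∈p─q; ∣p∣≤n; p⊂q⇒∣p∣<∣q∣)
open import Data.List using ([]; _∷_; _++_; map; filter; length; foldr)
import Data.List as List
import Data.List.Properties as List
open import Data.List.Membership.Propositional using (find) renaming (_∈_ to _∈ₗ_)
open import Data.List.Relation.Unary.All.Properties using (¬Any⇒All¬)
open import Data.List.Relation.Unary.Any using (Any; here; there)
import Data.List.Relation.Unary.Any as Any
open import Data.List.Relation.Unary.Any.Properties using (++⁺ˡ; ++⁺ʳ; ++⁻)
open import Data.Nat using (ℕ; zero; suc; _+_; _∸_; _≤_; _≰_; _<_; _≤ᵇ_; z≤n; s≤s; s≤s⁻¹)
open import Data.Nat.ListAction using (sum)
open import Data.Nat.Properties
open import Data.Product using (_×_; _,_; ∃; proj₁; proj₂)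
import Data.Product as Product
open import Data.Product.Properties using (≡-dec)
open import Data.Sum using (_⊎_; inj₁; inj₂; [_,_])
import Data.Sum as Sum
open import Data.Vec using (Vec; []; _∷_; lookup; tabulate)
open import Data.Vec.Properties
  using ([]=⇒lookup; lookup⇒[]=; lookup-map; lookup-zipWith; lookup∘tabulate; tabulate∘lookup; tabulate-cong)
open import Function using (_∘_; id; flip; _⇔_; mk⇔; Equivalence)
open import Function.Construct.Composition using (_⇔-∘_)
open import Function.Construct.Symmetry using (⇔-sym)
open import Level using (0ℓ)
open import Relation.Binary.PropositionalEquality
  using (_≡_; _≢_; refl; sym; trans; cong; cong₂; subst; subst₂; isEquivalence; module ≡-Reasoning)
open import Relation.Nullary using (¬_; Dec; yes; no; does; contradiction)
open import Relation.Nullary.Decidable using (dec-true; _⊎-dec_; _×-dec_; ¬?)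

open import Algebra.Properties.CommutativeSemigroup +-commutativeSemigroup
  using () renaming (interchange to +-interchange)

private
  variable
    n : ℕ

-- Subsets as Boolean vectors

lookup-∈ : ∀ {p : Subset n} {i} → i ∈ p → lookup p i ≡ true
lookup-∈ = []=⇒lookup

∈-lookup : ∀ {p : Subset n} {i} → lookup p i ≡ true → i ∈ p
∈-lookup {p = p} {i} = lookup⇒[]= i p

lookup-∉ : ∀ {p : Subset n} {i} → i ∉ p → lookup p i ≡ false
lookup-∉ {p = p} {i} i∉p with lookup p i in eq
... | true  = contradiction (∈-lookup eq) i∉p
... | false = refl

lookup-∁ : ∀ (p : Subset n) i → lookup (∁ p) i ≡ not (lookup p i)
lookup-∁ p i = lookup-map i not p

lookup-∩ : ∀ (p q : Subset n) i → lookup (p ∩ q) i ≡ lookup p i ∧ lookup q i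
lookup-∩ p q i = lookup-zipWith _∧_ i p q

lookup-∪ : ∀ (p q : Subset n) i → lookup (p ∪ q) i ≡ lookup p i ∨ lookup q i
lookup-∪ p q i = lookup-zipWith _∨_ i p q

lookup-─ : ∀ (p q : Subset n) i → lookup (p ─ q) i ≡ lookup p i ∧ not (lookup q i)
lookup-─ (a ∷ p) (true  ∷ q) zero    = sym (∧-zeroʳ a)
lookup-─ (a ∷ p) (false ∷ q) zero    = sym (∧-identityʳ a)
lookup-─ (a ∷ p) (b     ∷ q) (suc i) = lookup-─ p q i

lookup-ext : ∀ {p q : Subset n} → (∀ i → lookup p i ≡ lookup q i) → p ≡ q
lookup-ext {p = p} {q} eq = begin
  p                   ≡⟨ tabulate∘lookup p ⟨
  tabulate (lookup p) ≡⟨ tabulate-cong eq ⟩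
  tabulate (lookup q) ≡⟨ tabulate∘lookup q ⟩
  q                   ∎
  where open ≡-Reasoning

does-∈? : ∀ i (p : Subset n) → does (i ∈? p) ≡ lookup p i
does-∈? zero    (true  ∷ p) = refl
does-∈? zero    (false ∷ p) = refl
does-∈? (suc i) (_     ∷ p) = does-∈? i p

does⇒ : ∀ {ℓ} {A : Set ℓ} (a? : Dec A) → does a? ≡ true → A
does⇒ (yes a) _ = a

∈-tabulate⁻ : ∀ {P : Fin n → Set} (P? : ∀ i → Dec (P i)) {i} → i ∈ tabulate (does ∘ P?) → P i
∈-tabulate⁻ P? {i} i∈ = does⇒ (P? i) (trans (sym (lookup∘tabulate (does ∘ P?) i)) (lookup-∈ i∈))

∈-tabulate⁺ : ∀ {P : Fin n → Set} (P? : ∀ i → Dec (P i)) {i} → P i → i ∈ tabulate (does ∘ P?)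
∈-tabulate⁺ P? {i} Pi = ∈-lookup (trans (lookup∘tabulate (does ∘ P?) i) (dec-true (P? i) Pi))

x∈p─q⇒x∉q : ∀ {p q : Subset n} {x} → x ∈ p ─ q → x ∉ q
x∈p─q⇒x∉q {p = p} {q} {x} x∈p─q x∈q
  with () ← trans (sym (lookup-∈ x∈p─q))
              (trans (lookup-─ p q x) (trans (cong (λ b → lookup p x ∧ not b) (lookup-∈ x∈q)) (∧-zeroʳ _)))

⊆-of-─-empty : ∀ {p q : Subset n} → ¬ Nonempty (p ─ q) → p ⊆ q
⊆-of-─-empty {q = q} empty {i} i∈p with i ∈? q
... | yes i∈q = i∈q
... | no  i∉q = contradiction (i , x∈p∧x∉q⇒x∈p─q i∈p i∉q) empty

∁-involutive : ∀ (p : Subset n) → ∁ (∁ p) ≡ p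
∁-involutive p = lookup-ext λ i →
  trans (lookup-∁ (∁ p) i) (trans (cong not (lookup-∁ p i)) (not-involutive (lookup p i)))

infixr 3 _⇒ᵇ_
infixr 6 _∧-intro_

_⇒ᵇ_ : Bool → Bool → Bool
a ⇒ᵇ b = not a ∨ b

⇒ᵇ-intro : ∀ {a b} → (a ≡ true → b ≡ true) → (a ⇒ᵇ b) ≡ true
⇒ᵇ-intro {true}  a⇒b = a⇒b refl
⇒ᵇ-intro {false} _   = refl

⇒ᵇ-elim : ∀ {a b} → (a ⇒ᵇ b) ≡ true → a ≡ true → b ≡ true
⇒ᵇ-elim a⇒b refl = a⇒b

_∧-intro_ : ∀ {a b} → a ≡ true → b ≡ true → a ∧ b ≡ true
refl ∧-intro refl = refl

∧-elim : ∀ {a b} → a ∧ b ≡ true → a ≡ true × b ≡ true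
∧-elim {true} b≡true = refl , b≡true

⊆⇒ᵇ : ∀ {p q : Subset n} → p ⊆ q → ∀ i → (lookup p i ⇒ᵇ lookup q i) ≡ true
⊆⇒ᵇ p⊆q i = ⇒ᵇ-intro (lookup-∈ ∘ p⊆q ∘ ∈-lookup)

-- Pointwise Boolean facts below are proved by evaluating `tautology` on all 2^m rows,
-- so the proof of `tautology m f ≡ true` is `refl`.
tautology : ∀ m → (Vec Bool m → Bool) → Bool
tautology zero    f = f []
tautology (suc m) f = tautology m (f ∘ (true ∷_)) ∧ tautology m (f ∘ (false ∷_))

tautology-sound : ∀ m (f : Vec Bool m → Bool) → tautology m f ≡ true → ∀ bs → f bs ≡ true
tautology-sound zero    f taut []           = taut
tautology-sound (suc m) f taut (true  ∷ bs) = tautology-sound m _ (proj₁ (∧-elim taut)) bs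
tautology-sound (suc m) f taut (false ∷ bs) =
  tautology-sound m _ (proj₂ (∧-elim {tautology m (f ∘ (true ∷_))} taut)) bs

toℕ : Bool → ℕ
toℕ false = 0
toℕ true  = 1

toℕ-mono : ∀ {a b} → (a ≡ true → b ≡ true) → toℕ a ≤ toℕ b
toℕ-mono {false} _   = z≤n
toℕ-mono {true}  a⇒b rewrite a⇒b refl = ≤-refl

≤ᵇ-sound : ∀ {a b} → (a ≤ᵇ b) ≡ true → a ≤ b
≤ᵇ-sound {a} {b} a≤b = ≤ᵇ⇒≤ a b (subst T (sym a≤b) _)

m+m≰m : ∀ {m} → 0 < m → m + m ≰ m
m+m≰m {m} 0<m m+m≤m = <⇒≢ 0<m (sym (n≤0⇒n≡0 (+-cancelʳ-≤ m m 0 m+m≤m)))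

0<k∸1 : ∀ {k} → 2 ≤ k → 0 < k ∸ 1
0<k∸1 = ∸-monoˡ-≤ 1

module _ {a} {X : Set a} where

  sum-map-+ : ∀ (f g : X → ℕ) xs →
              sum (map (λ x → f x + g x) xs) ≡ sum (map f xs) + sum (map g xs)
  sum-map-+ f g []       = refl
  sum-map-+ f g (x ∷ xs) = begin
    (f x + g x) + sum (map (λ x → f x + g x) xs)     ≡⟨ cong (f x + g x +_) (sum-map-+ f g xs) ⟩
    (f x + g x) + (sum (map f xs) + sum (map g xs)) ≡⟨ +-interchange (f x) (g x) _ _ ⟩
    (f x + sum (map f xs)) + (g x + sum (map g xs)) ∎
    where open ≡-Reasoning

  sum-map-mono : ∀ (f g : X → ℕ) xs → (∀ {x} → x ∈ₗ xs → f x ≤ g x) →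
                 sum (map f xs) ≤ sum (map g xs)
  sum-map-mono f g []       _   = z≤n
  sum-map-mono f g (x ∷ xs) f≤g = +-mono-≤ (f≤g (here refl)) (sum-map-mono f g xs (f≤g ∘ there))

-- Extended naturals and node capacities

infix 4 _≤∞_

data _≤∞_ : ℕ∞ → ℕ∞ → Set where
  fin≤fin : ∀ {a b} → a ≤ b → fin a ≤∞ fin b
  ≤∞-top  : ∀ {x} → x ≤∞ ∞

≤∞-refl : ∀ {x} → x ≤∞ x
≤∞-refl {fin a} = fin≤fin ≤-refl
≤∞-refl {∞}     = ≤∞-top

≤∞-trans : ∀ {x y z} → x ≤∞ y → y ≤∞ z → x ≤∞ z
≤∞-trans (fin≤fin a≤b) (fin≤fin b≤c) = fin≤fin (≤-trans a≤b b≤c)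
≤∞-trans _             ≤∞-top        = ≤∞-top

z≤∞ : ∀ x → fin 0 ≤∞ x
z≤∞ (fin a) = fin≤fin z≤n
z≤∞ ∞       = ≤∞-top

fin-injective : ∀ {a b} → fin a ≡ fin b → a ≡ b
fin-injective refl = refl

+∞-identityˡ : ∀ x → fin 0 +∞ x ≡ x
+∞-identityˡ (fin a) = refl
+∞-identityˡ ∞       = refl

+∞-identityʳ : ∀ x → x +∞ fin 0 ≡ x
+∞-identityʳ (fin a) = cong fin (+-identityʳ a)
+∞-identityʳ ∞       = refl

+∞-comm : ∀ x y → x +∞ y ≡ y +∞ x
+∞-comm (fin a) (fin b) = cong fin (+-comm a b)
+∞-comm (fin a) ∞       = refl
+∞-comm ∞       (fin b) = refl
+∞-comm ∞       ∞       = refl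

+∞-assoc : ∀ x y z → (x +∞ y) +∞ z ≡ x +∞ (y +∞ z)
+∞-assoc (fin a) (fin b) (fin c) = cong fin (+-assoc a b c)
+∞-assoc (fin a) (fin b) ∞       = refl
+∞-assoc (fin a) ∞       z       = refl
+∞-assoc ∞       y       z       = refl

+∞-commutativeSemigroup : CommutativeSemigroup 0ℓ 0ℓ
+∞-commutativeSemigroup = record
  { isCommutativeSemigroup = record
    { isSemigroup = record
      { isMagma = record { isEquivalence = isEquivalence ; ∙-cong = cong₂ _+∞_ }
      ; assoc   = +∞-assoc
      }
    ; comm = +∞-comm
    }
  }

open import Algebra.Properties.CommutativeSemigroup +∞-commutativeSemigroup
  using () renaming (interchange to +∞-interchange)

+∞-mono-≤∞ : ∀ {x y z w} → x ≤∞ y → z ≤∞ w → x +∞ z ≤∞ y +∞ w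
+∞-mono-≤∞ (fin≤fin a≤b) (fin≤fin c≤d) = fin≤fin (+-mono-≤ a≤b c≤d)
+∞-mono-≤∞ {y = fin _} (fin≤fin _) ≤∞-top = ≤∞-top
+∞-mono-≤∞ {y = ∞}     _           _      = ≤∞-top

x≤∞x+∞y : ∀ x y → x ≤∞ x +∞ y
x≤∞x+∞y (fin a) (fin b) = fin≤fin (m≤m+n a b)
x≤∞x+∞y (fin a) ∞       = ≤∞-top
x≤∞x+∞y ∞       y       = ≤∞-top

y≤∞x+∞y : ∀ x y → y ≤∞ x +∞ y
y≤∞x+∞y x y = subst (y ≤∞_) (+∞-comm y x) (x≤∞x+∞y y x)

squeeze : ∀ {x y c} → x +∞ y ≤∞ fin c +∞ fin c → fin c ≤∞ x → fin c ≤∞ y → x ≡ fin c × y ≡ fin c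
squeeze {c = c} (fin≤fin a+b≤c+c) (fin≤fin {a = .c} {a} c≤a) (fin≤fin {b = b} c≤b) =
  cong fin (≤-antisym (+-cancelʳ-≤ b a c (≤-trans a+b≤c+c (+-monoʳ-≤ c c≤b))) c≤a) ,
  cong fin (≤-antisym (+-cancelˡ-≤ a b c (≤-trans a+b≤c+c (+-monoˡ-≤ c c≤a))) c≤b)

infixl 21 _×∞_

_×∞_ : ℕ → ℕ∞ → ℕ∞
zero  ×∞ x = fin 0
suc m ×∞ x = x +∞ (m ×∞ x)

×∞-distribʳ-+ : ∀ x m m′ → (m + m′) ×∞ x ≡ (m ×∞ x) +∞ (m′ ×∞ x)
×∞-distribʳ-+ x zero    m′ = sym (+∞-identityˡ _)
×∞-distribʳ-+ x (suc m) m′ = trans (cong (x +∞_) (×∞-distribʳ-+ x m m′)) (sym (+∞-assoc x _ _))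

×∞-monoˡ : ∀ x {m m′} → m ≤ m′ → m ×∞ x ≤∞ m′ ×∞ x
×∞-monoˡ x {m′ = m′} z≤n = z≤∞ (m′ ×∞ x)
×∞-monoˡ x (s≤s m≤m′)    = +∞-mono-≤∞ ≤∞-refl (×∞-monoˡ x m≤m′)

indicator : Bool → ℕ∞ → ℕ∞
indicator b x = if b then x else fin 0

indicator-+∞ : ∀ a b x → indicator a x +∞ indicator b x ≡ (toℕ a + toℕ b) ×∞ x
indicator-+∞ a b x = trans (cong₂ _+∞_ (toℕ-×∞ a) (toℕ-×∞ b)) (sym (×∞-distribʳ-+ x (toℕ a) (toℕ b)))
  where
  toℕ-×∞ : ∀ a → indicator a x ≡ toℕ a ×∞ x
  toℕ-×∞ false = refl
  toℕ-×∞ true  = sym (+∞-identityʳ x)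

indicator-+∞-mono : ∀ a b c d x → toℕ a + toℕ b ≤ toℕ c + toℕ d →
                    indicator a x +∞ indicator b x ≤∞ indicator c x +∞ indicator d x
indicator-+∞-mono a b c d x ab≤cd =
  subst₂ _≤∞_ (sym (indicator-+∞ a b x)) (sym (indicator-+∞ c d x)) (×∞-monoˡ x ab≤cd)

Σ∞ : (Fin n → ℕ∞) → ℕ∞
Σ∞ {zero}  f = fin 0
Σ∞ {suc n} f = f zero +∞ Σ∞ (f ∘ suc)

Σ∞-+ : ∀ (f g : Fin n → ℕ∞) → Σ∞ (λ i → f i +∞ g i) ≡ Σ∞ f +∞ Σ∞ g
Σ∞-+ {zero}  f g = refl
Σ∞-+ {suc n} f g = begin
  (f zero +∞ g zero) +∞ Σ∞ (λ i → f (suc i) +∞ g (suc i))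
    ≡⟨ cong ((f zero +∞ g zero) +∞_) (Σ∞-+ (f ∘ suc) (g ∘ suc)) ⟩
  (f zero +∞ g zero) +∞ (Σ∞ (f ∘ suc) +∞ Σ∞ (g ∘ suc))
    ≡⟨ +∞-interchange (f zero) (g zero) _ _ ⟩
  (f zero +∞ Σ∞ (f ∘ suc)) +∞ (g zero +∞ Σ∞ (g ∘ suc))
    ∎
  where open ≡-Reasoning

Σ∞-mono : ∀ {f g : Fin n → ℕ∞} → (∀ i → f i ≤∞ g i) → Σ∞ f ≤∞ Σ∞ g
Σ∞-mono {zero}  f≤g = ≤∞-refl
Σ∞-mono {suc n} f≤g = +∞-mono-≤∞ (f≤g zero) (Σ∞-mono (f≤g ∘ suc))

Σ∞-zero : ∀ (f : Fin n → ℕ∞) → (∀ i → f i ≡ fin 0) → Σ∞ f ≡ fin 0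
Σ∞-zero {zero}  f f≡0 = refl
Σ∞-zero {suc n} f f≡0 rewrite f≡0 zero = trans (+∞-identityˡ _) (Σ∞-zero (f ∘ suc) (f≡0 ∘ suc))

Σ∞-single : ∀ (f : Fin n → ℕ∞) i → (∀ j → j ≢ i → f j ≡ fin 0) → Σ∞ f ≡ f i
Σ∞-single f zero    f≡0 =
  trans (cong (f zero +∞_) (Σ∞-zero (f ∘ suc) (λ j → f≡0 (suc j) λ ()))) (+∞-identityʳ (f zero))
Σ∞-single f (suc i) f≡0 rewrite f≡0 zero (λ ()) =
  trans (+∞-identityˡ _) (Σ∞-single (f ∘ suc) i (λ j j≢i → f≡0 (suc j) (j≢i ∘ Fin.suc-injective)))

≤∞-Σ∞ : ∀ (f : Fin n → ℕ∞) i → f i ≤∞ Σ∞ f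
≤∞-Σ∞ f zero    = x≤∞x+∞y (f zero) _
≤∞-Σ∞ f (suc i) = ≤∞-trans (≤∞-Σ∞ (f ∘ suc) i) (y≤∞x+∞y (f zero) _)

+∞-≤∞-Σ∞ : ∀ (f : Fin n → ℕ∞) {i j} → i ≢ j → f i +∞ f j ≤∞ Σ∞ f
+∞-≤∞-Σ∞ f {zero}  {zero}  i≢j = contradiction refl i≢j
+∞-≤∞-Σ∞ f {zero}  {suc j} _   = +∞-mono-≤∞ ≤∞-refl (≤∞-Σ∞ (f ∘ suc) j)
+∞-≤∞-Σ∞ f {suc i} {zero}  _   =
  subst (_≤∞ Σ∞ f) (+∞-comm (f zero) _) (+∞-mono-≤∞ ≤∞-refl (≤∞-Σ∞ (f ∘ suc) i))
+∞-≤∞-Σ∞ f {suc i} {suc j} i≢j =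
  ≤∞-trans (+∞-≤∞-Σ∞ (f ∘ suc) (i≢j ∘ cong suc)) (y≤∞x+∞y (f zero) _)

module _ (k : ℕ) (Q : Subset n) where

  qSum≡Σ∞ : ∀ S → qSum k Q S ≡ Σ∞ (λ i → indicator (lookup S i) (q k Q i))
  qSum≡Σ∞ S = tabulate-sum id
    where
    tabulate-sum : ∀ {m} (t : Fin m → Fin n) →
      foldr (λ v acc → if lookup S v then q k Q v +∞ acc else acc) (fin 0) (List.tabulate t)
      ≡ Σ∞ (λ i → indicator (lookup S (t i)) (q k Q (t i)))
    tabulate-sum {zero}  t = refl
    tabulate-sum {suc m} t with lookup S (t zero)
    ... | true  = cong (q k Q (t zero) +∞_) (tabulate-sum (t ∘ suc))
    ... | false = trans (tabulate-sum (t ∘ suc)) (sym (+∞-identityˡ _))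

  private
    indicator-∈ : ∀ {S v} → v ∈ S → indicator (lookup S v) (q k Q v) ≡ q k Q v
    indicator-∈ v∈S = cong (λ b → indicator b _) (lookup-∈ v∈S)

  qSum-empty : ∀ {S} → ¬ Nonempty S → qSum k Q S ≡ fin 0
  qSum-empty {S} S-empty = trans (qSum≡Σ∞ S) (Σ∞-zero _ λ i →
    cong (λ b → indicator b (q k Q i)) (lookup-∉ (λ i∈S → S-empty (i , i∈S))))

  qSum-⁅⁆ : ∀ v → qSum k Q ⁅ v ⁆ ≡ q k Q v
  qSum-⁅⁆ v = trans (qSum≡Σ∞ ⁅ v ⁆) (trans (Σ∞-single _ v others) (indicator-∈ (x∈⁅x⁆ v)))
    where
    others : ∀ j → j ≢ v → indicator (lookup ⁅ v ⁆ j) (q k Q j) ≡ fin 0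
    others j j≢v = cong (λ b → indicator b (q k Q j)) (lookup-∉ (x≢y⇒x∉⁅y⁆ j≢v))

  q≤∞qSum : ∀ {S v} → v ∈ S → q k Q v ≤∞ qSum k Q S
  q≤∞qSum {S} {v} v∈S = subst₂ _≤∞_ (indicator-∈ v∈S) (sym (qSum≡Σ∞ S)) (≤∞-Σ∞ _ v)

  q+q≤∞qSum : ∀ {S v w} → v ≢ w → v ∈ S → w ∈ S → q k Q v +∞ q k Q w ≤∞ qSum k Q S
  q+q≤∞qSum {S} v≢w v∈S w∈S =
    subst₂ _≤∞_ (cong₂ _+∞_ (indicator-∈ v∈S) (indicator-∈ w∈S)) (sym (qSum≡Σ∞ S)) (+∞-≤∞-Σ∞ _ v≢w)

  qSum-submodular : ∀ {S₁ S₂ T₁ T₂} →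
    (∀ i → toℕ (lookup S₁ i) + toℕ (lookup S₂ i) ≤ toℕ (lookup T₁ i) + toℕ (lookup T₂ i)) →
    qSum k Q S₁ +∞ qSum k Q S₂ ≤∞ qSum k Q T₁ +∞ qSum k Q T₂
  qSum-submodular {S₁} {S₂} {T₁} {T₂} pointwise = subst₂ _≤∞_ (Σ∞-qSum S₁ S₂) (Σ∞-qSum T₁ T₂)
    (Σ∞-mono λ i → indicator-+∞-mono (lookup S₁ i) (lookup S₂ i) (lookup T₁ i) (lookup T₂ i) _ (pointwise i))
    where
    Σ∞-qSum : ∀ S S′ → Σ∞ (λ i → indicator (lookup S i) (q k Q i) +∞ indicator (lookup S′ i) (q k Q i))
                       ≡ qSum k Q S +∞ qSum k Q S′
    Σ∞-qSum S S′ = trans (Σ∞-+ (λ i → indicator (lookup S i) (q k Q i)) _)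
                         (sym (cong₂ _+∞_ (qSum≡Σ∞ S) (qSum≡Σ∞ S′)))

  k∸1≤∞q : ∀ v → fin (k ∸ 1) ≤∞ q k Q v
  k∸1≤∞q v with lookup Q v
  ... | true  = ≤∞-refl
  ... | false = ≤∞-top

  q-∈ : ∀ {v} → v ∈ Q → q k Q v ≡ fin (k ∸ 1)
  q-∈ v∈Q rewrite lookup-∈ v∈Q = refl

  q-∉ : ∀ {v} → v ∉ Q → q k Q v ≡ ∞
  q-∉ v∉Q rewrite lookup-∉ v∉Q = refl

-- Bisets, coverage and degrees

∈∂⁻ : ∀ {𝔸 : Biset n} {i} → i ∈ ∂ 𝔸 → i ∈ outer 𝔸 × i ∉ inner 𝔸
∈∂⁻ {𝔸 = A , A⁺} i∈∂ = p─q⊆p A⁺ A i∈∂ , x∈p─q⇒x∉q i∈∂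

∈∂⁺ : ∀ {𝔸 : Biset n} {i} → i ∈ outer 𝔸 → i ∉ inner 𝔸 → i ∈ ∂ 𝔸
∈∂⁺ = x∈p∧x∉q⇒x∈p─q

outer≡inner : ∀ {𝔸 : Biset n} → IsBiset 𝔸 → ¬ Nonempty (∂ 𝔸) → outer 𝔸 ≡ inner 𝔸
outer≡inner {𝔸 = A , A⁺} A⊆A⁺ ∂-empty = ⊆-antisym (⊆-of-─-empty ∂-empty) A⊆A⁺

∂⊆⇒ᵇ : ∀ {𝔸 : Biset n} {p} → ∂ 𝔸 ⊆ p → ∀ i →
       (lookup (outer 𝔸) i ∧ not (lookup (inner 𝔸) i) ⇒ᵇ lookup p i) ≡ true
∂⊆⇒ᵇ {𝔸 = A , A⁺} {p} ∂⊆p i = subst (λ b → (b ⇒ᵇ lookup p i) ≡ true) (lookup-─ A⁺ A i) (⊆⇒ᵇ ∂⊆p i)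

co : Biset n → Biset n
co (A , A⁺) = ∁ A⁺ , ∁ A

∈-star-co : ∀ {𝔸 : Biset n} {i} → i ∈ inner 𝔸 → i ∈ star (co 𝔸)
∈-star-co {𝔸 = A , A⁺} {i} = subst (i ∈_) (sym (∁-involutive A))

∂-co : ∀ (𝔸 : Biset n) → ∂ (co 𝔸) ≡ ∂ 𝔸
∂-co (A , A⁺) = lookup-ext λ i → begin
  lookup (∁ A ─ ∁ A⁺) i                       ≡⟨ lookup-─ (∁ A) (∁ A⁺) i ⟩
  lookup (∁ A) i ∧ not (lookup (∁ A⁺) i)      ≡⟨ cong₂ (λ a a⁺ → a ∧ not a⁺) (lookup-∁ A i) (lookup-∁ A⁺ i) ⟩
  not (lookup A i) ∧ not (not (lookup A⁺ i)) ≡⟨ cong (not (lookup A i) ∧_) (not-involutive _) ⟩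
  not (lookup A i) ∧ lookup A⁺ i              ≡⟨ ∧-comm (not (lookup A i)) _ ⟩
  lookup A⁺ i ∧ not (lookup A i)              ≡⟨ lookup-─ A⁺ A i ⟨
  lookup (A⁺ ─ A) i                           ∎
  where open ≡-Reasoning

∈∂-co : ∀ {𝔸 : Biset n} {i} → i ∈ ∂ 𝔸 → i ∈ ∂ (co 𝔸)
∈∂-co {𝔸 = 𝔸} {i} = subst (i ∈_) (sym (∂-co 𝔸))

crosses : (a a⁺ b b⁺ : Bool) → Bool
crosses a a⁺ b b⁺ = a ∧ not b⁺ ∨ b ∧ not a⁺

covers : Biset n → Edge n → Bool
covers (A , A⁺) (u , v) = crosses (lookup A u) (lookup A⁺ u) (lookup A v) (lookup A⁺ v)

does-covers? : ∀ (e : Edge n) 𝔸 → does (covers? e 𝔸) ≡ covers 𝔸 e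
does-covers? (u , v) (A , A⁺)
  rewrite does-∈? u A | does-∈? v A | does-∈? v (∁ A⁺) | does-∈? u (∁ A⁺)
        | lookup-∁ A⁺ v | lookup-∁ A⁺ u = refl

covers-sound : ∀ {e : Edge n} {𝔸} → covers 𝔸 e ≡ true → Covers e 𝔸
covers-sound {e = e} {𝔸} c = does⇒ (covers? e 𝔸) (trans (does-covers? e 𝔸) c)

Covers-co : ∀ e (𝔸 : Biset n) → Covers e (co 𝔸) ⇔ Covers e 𝔸
Covers-co (u , v) (A , A⁺) rewrite ∁-involutive A = mk⇔ mirror mirror
  where
  mirror : ∀ {P Q R S : Set} → (P × Q) ⊎ (R × S) → (S × R) ⊎ (Q × P)
  mirror = Sum.swap ∘ Sum.map Product.swap Product.swap

CoveredBy : Graph n → Biset n → Set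
CoveredBy G 𝔸 = Any (λ e → Covers e 𝔸) G

deg≡sum : ∀ (G : Graph n) 𝔸 → deg G 𝔸 ≡ sum (map (toℕ ∘ covers 𝔸) G)
deg≡sum []      𝔸 = refl
deg≡sum (e ∷ G) 𝔸 rewrite sym (does-covers? e 𝔸) with does (covers? e 𝔸)
... | true  = cong suc (deg≡sum G 𝔸)
... | false = deg≡sum G 𝔸

deg-++ : ∀ (G H : Graph n) 𝔸 → deg (G ++ H) 𝔸 ≡ deg G 𝔸 + deg H 𝔸
deg-++ G H 𝔸 = trans (cong length (List.filter-++ covers?𝔸 G H)) (List.length-++ (filter covers?𝔸 G))
  where
  covers?𝔸 : ∀ e → Dec (Covers e 𝔸)
  covers?𝔸 e = covers? e 𝔸

deg-co : ∀ (G : Graph n) 𝔸 → deg G (co 𝔸) ≡ deg G 𝔸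
deg-co G 𝔸 = cong length (List.filter-≐ (λ e → covers? e (co 𝔸)) (λ e → covers? e 𝔸)
  ((λ {e} → Equivalence.to (Covers-co e 𝔸)) , (λ {e} → Equivalence.from (Covers-co e 𝔸))) G)

covered⇒0<deg : ∀ {G : Graph n} {𝔸} → CoveredBy G 𝔸 → 0 < deg G 𝔸
covered⇒0<deg {𝔸 = 𝔸} = List.filter-some (λ e → covers? e 𝔸)

0<deg⇒covered : ∀ (G : Graph n) 𝔸 → 0 < deg G 𝔸 → CoveredBy G 𝔸
0<deg⇒covered (e ∷ G) 𝔸 0<d with covers? e 𝔸
... | yes c = here c
... | no ¬c = there (0<deg⇒covered G 𝔸
                      (subst (λ es → 0 < length es) (List.filter-reject (λ e → covers? e 𝔸) ¬c) 0<d))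

uncovered⇒deg≡0 : ∀ (G : Graph n) 𝔸 → ¬ CoveredBy G 𝔸 → deg G 𝔸 ≡ 0
uncovered⇒deg≡0 G 𝔸 ¬c = cong length (List.filter-none (λ e → covers? e 𝔸) (¬Any⇒All¬ G ¬c))

deg≡0⇒uncovered : ∀ {G : Graph n} {𝔸} → deg G 𝔸 ≡ 0 → ¬ CoveredBy G 𝔸
deg≡0⇒uncovered d≡0 c = <⇒≢ (covered⇒0<deg c) (sym d≡0)

uncovered⇒¬covers : ∀ {G : Graph n} {𝔸 e} → ¬ CoveredBy G 𝔸 → e ∈ₗ G → covers 𝔸 e ≡ false
uncovered⇒¬covers {𝔸 = 𝔸} {e} ¬c e∈G with covers 𝔸 e in c
... | true  = contradiction (Any.map (λ { refl → covers-sound c }) e∈G) ¬c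
... | false = refl

deg-mono : ∀ (G : Graph n) {𝔸 𝔹} → (∀ {e} → e ∈ₗ G → covers 𝔸 e ≡ true → covers 𝔹 e ≡ true) →
           deg G 𝔸 ≤ deg G 𝔹
deg-mono G {𝔸} {𝔹} 𝔸⇒𝔹 =
  subst₂ _≤_ (sym (deg≡sum G 𝔸)) (sym (deg≡sum G 𝔹)) (sum-map-mono _ _ G (toℕ-mono ∘ 𝔸⇒𝔹))

deg-mono₂ : ∀ (G : Graph n) {𝔸 𝔹 ℂ 𝔻} →
  (∀ {e} → e ∈ₗ G → toℕ (covers 𝔸 e) + toℕ (covers 𝔹 e) ≤ toℕ (covers ℂ e) + toℕ (covers 𝔻 e)) →
  deg G 𝔸 + deg G 𝔹 ≤ deg G ℂ + deg G 𝔻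
deg-mono₂ G {𝔸} {𝔹} {ℂ} {𝔻} pointwise = begin
  deg G 𝔸 + deg G 𝔹                                         ≡⟨ deg-+ 𝔸 𝔹 ⟩
  sum (map (λ e → toℕ (covers 𝔸 e) + toℕ (covers 𝔹 e)) G) ≤⟨ sum-map-mono _ _ G pointwise ⟩
  sum (map (λ e → toℕ (covers ℂ e) + toℕ (covers 𝔻 e)) G) ≡⟨ deg-+ ℂ 𝔻 ⟨
  deg G ℂ + deg G 𝔻                                         ∎
  where
  open ≤-Reasoning
  deg-+ : ∀ 𝔸 𝔹 → deg G 𝔸 + deg G 𝔹 ≡ sum (map (λ e → toℕ (covers 𝔸 e) + toℕ (covers 𝔹 e)) G)
  deg-+ 𝔸 𝔹 = trans (cong₂ _+_ (deg≡sum G 𝔸) (deg≡sum G 𝔹)) (sym (sum-map-+ _ _ G))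

covers-submodular : ∀ {𝔸 𝔹 : Biset n} → IsBiset 𝔸 → IsBiset 𝔹 → ∀ e →
  toℕ (covers (𝔸 ∩ᵇ 𝔹) e) + toℕ (covers (𝔸 ∪ᵇ 𝔹) e) ≤ toℕ (covers 𝔸 e) + toℕ (covers 𝔹 e)
covers-submodular {𝔸 = A , A⁺} {B , B⁺} A⊆A⁺ B⊆B⁺ (u , v)
  rewrite lookup-∩ A B u | lookup-∩ A⁺ B⁺ u | lookup-∩ A B v | lookup-∩ A⁺ B⁺ v
        | lookup-∪ A B u | lookup-∪ A⁺ B⁺ u | lookup-∪ A B v | lookup-∪ A⁺ B⁺ v
  = ≤ᵇ-sound (⇒ᵇ-elim
      (tautology-sound 8 table refl
        (lookup A u ∷ lookup A⁺ u ∷ lookup B u ∷ lookup B⁺ u ∷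
         lookup A v ∷ lookup A⁺ v ∷ lookup B v ∷ lookup B⁺ v ∷ []))
      (⊆⇒ᵇ A⊆A⁺ u ∧-intro ⊆⇒ᵇ B⊆B⁺ u ∧-intro ⊆⇒ᵇ A⊆A⁺ v ∧-intro ⊆⇒ᵇ B⊆B⁺ v))
  where
  table : Vec Bool 8 → Bool
  table (aᵤ ∷ a⁺ᵤ ∷ bᵤ ∷ b⁺ᵤ ∷ aᵥ ∷ a⁺ᵥ ∷ bᵥ ∷ b⁺ᵥ ∷ []) =
    (aᵤ ⇒ᵇ a⁺ᵤ) ∧ (bᵤ ⇒ᵇ b⁺ᵤ) ∧ (aᵥ ⇒ᵇ a⁺ᵥ) ∧ (bᵥ ⇒ᵇ b⁺ᵥ) ⇒ᵇ
      toℕ (crosses (aᵤ ∧ bᵤ) (a⁺ᵤ ∧ b⁺ᵤ) (aᵥ ∧ bᵥ) (a⁺ᵥ ∧ b⁺ᵥ))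
      + toℕ (crosses (aᵤ ∨ bᵤ) (a⁺ᵤ ∨ b⁺ᵤ) (aᵥ ∨ bᵥ) (a⁺ᵥ ∨ b⁺ᵥ))
      ≤ᵇ toℕ (crosses aᵤ a⁺ᵤ aᵥ a⁺ᵥ) + toℕ (crosses bᵤ b⁺ᵤ bᵥ b⁺ᵥ)

∂-submodular : ∀ {𝔸 𝔹 : Biset n} → IsBiset 𝔸 → IsBiset 𝔹 → ∀ i →
  toℕ (lookup (∂ (𝔸 ∩ᵇ 𝔹)) i) + toℕ (lookup (∂ (𝔸 ∪ᵇ 𝔹)) i) ≤ toℕ (lookup (∂ 𝔸) i) + toℕ (lookup (∂ 𝔹) i)
∂-submodular {𝔸 = A , A⁺} {B , B⁺} A⊆A⁺ B⊆B⁺ i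
  rewrite lookup-─ (A⁺ ∩ B⁺) (A ∩ B) i | lookup-─ (A⁺ ∪ B⁺) (A ∪ B) i
        | lookup-─ A⁺ A i | lookup-─ B⁺ B i
        | lookup-∩ A B i | lookup-∩ A⁺ B⁺ i | lookup-∪ A B i | lookup-∪ A⁺ B⁺ i
  = ≤ᵇ-sound (⇒ᵇ-elim
      (tautology-sound 4 table refl (lookup A i ∷ lookup A⁺ i ∷ lookup B i ∷ lookup B⁺ i ∷ []))
      (⊆⇒ᵇ A⊆A⁺ i ∧-intro ⊆⇒ᵇ B⊆B⁺ i))
  where
  table : Vec Bool 4 → Bool
  table (a ∷ a⁺ ∷ b ∷ b⁺ ∷ []) =
    (a ⇒ᵇ a⁺) ∧ (b ⇒ᵇ b⁺) ⇒ᵇ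
      toℕ ((a⁺ ∧ b⁺) ∧ not (a ∧ b)) + toℕ ((a⁺ ∨ b⁺) ∧ not (a ∨ b))
      ≤ᵇ toℕ (a⁺ ∧ not a) + toℕ (b⁺ ∧ not b)

covers-escape⇒covers : ∀ {𝔸 ℂ : Biset n} → IsBiset 𝔸 → ∂ 𝔸 ⊆ inner ℂ → ∂ ℂ ⊆ ∁ (inner 𝔸) →
  ∀ e → covers 𝔸 e ≡ false →
  let X = inner 𝔸 ─ inner ℂ in covers (X , X) e ≡ true → covers ℂ e ≡ true
covers-escape⇒covers {𝔸 = A , A⁺} {C , C⁺} A⊆A⁺ ∂A⊆C ∂C⊆∁A (u , v) ¬covers
  rewrite lookup-─ A C u | lookup-─ A C v
  = ⇒ᵇ-elim (⇒ᵇ-elim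
      (tautology-sound 8 table refl
        (lookup A u ∷ lookup A⁺ u ∷ lookup C u ∷ lookup C⁺ u ∷
         lookup A v ∷ lookup A⁺ v ∷ lookup C v ∷ lookup C⁺ v ∷ []))
      (profile-ok u ∧-intro profile-ok v ∧-intro cong not ¬covers))
  where
  profile : (a a⁺ c c⁺ : Bool) → Bool
  profile a a⁺ c c⁺ = (a ⇒ᵇ a⁺) ∧ (a⁺ ∧ not a ⇒ᵇ c) ∧ (c⁺ ∧ not c ⇒ᵇ not a)
  profile-ok : ∀ i → profile (lookup A i) (lookup A⁺ i) (lookup C i) (lookup C⁺ i) ≡ true
  profile-ok i = ⊆⇒ᵇ A⊆A⁺ i ∧-intro ∂⊆⇒ᵇ ∂A⊆C i
                 ∧-intro subst (λ b → (_ ⇒ᵇ b) ≡ true) (lookup-∁ A i) (∂⊆⇒ᵇ ∂C⊆∁A i)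
  table : Vec Bool 8 → Bool
  table (aᵤ ∷ a⁺ᵤ ∷ cᵤ ∷ c⁺ᵤ ∷ aᵥ ∷ a⁺ᵥ ∷ cᵥ ∷ c⁺ᵥ ∷ []) =
    profile aᵤ a⁺ᵤ cᵤ c⁺ᵤ ∧ profile aᵥ a⁺ᵥ cᵥ c⁺ᵥ ∧ not (crosses aᵤ a⁺ᵤ aᵥ a⁺ᵥ) ⇒ᵇ
      crosses (aᵤ ∧ not cᵤ) (aᵤ ∧ not cᵤ) (aᵥ ∧ not cᵥ) (aᵥ ∧ not cᵥ) ⇒ᵇ crosses cᵤ c⁺ᵤ cᵥ c⁺ᵥ

covers-escapes-≤ : ∀ {𝔸 ℂ : Biset n} → IsBiset 𝔸 → ∂ 𝔸 ⊆ inner ℂ → outer ℂ ⊆ inner ℂ →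
  ∀ e → covers 𝔸 e ≡ false →
  let X = inner 𝔸 ─ inner ℂ ; Y = inner (co 𝔸) ─ inner ℂ in
  toℕ (covers (X , X) e) + toℕ (covers (Y , Y) e) ≤ toℕ (covers ℂ e) + toℕ (covers 𝔸 e)
covers-escapes-≤ {𝔸 = A , A⁺} {C , C⁺} A⊆A⁺ ∂A⊆C C⁺⊆C (u , v) ¬covers
  rewrite lookup-─ A C u | lookup-─ A C v | lookup-─ (∁ A⁺) C u | lookup-─ (∁ A⁺) C v
        | lookup-∁ A⁺ u | lookup-∁ A⁺ v | ¬covers
  = ≤ᵇ-sound (⇒ᵇ-elim
      (tautology-sound 8 table refl
        (lookup A u ∷ lookup A⁺ u ∷ lookup C u ∷ lookup C⁺ u ∷
         lookup A v ∷ lookup A⁺ v ∷ lookup C v ∷ lookup C⁺ v ∷ []))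
      (profile-ok u ∧-intro profile-ok v ∧-intro cong not ¬covers))
  where
  profile : (a a⁺ c c⁺ : Bool) → Bool
  profile a a⁺ c c⁺ = (a ⇒ᵇ a⁺) ∧ (a⁺ ∧ not a ⇒ᵇ c) ∧ (c⁺ ⇒ᵇ c)
  profile-ok : ∀ i → profile (lookup A i) (lookup A⁺ i) (lookup C i) (lookup C⁺ i) ≡ true
  profile-ok i = ⊆⇒ᵇ A⊆A⁺ i ∧-intro ∂⊆⇒ᵇ ∂A⊆C i ∧-intro ⊆⇒ᵇ C⁺⊆C i
  table : Vec Bool 8 → Bool
  table (aᵤ ∷ a⁺ᵤ ∷ cᵤ ∷ c⁺ᵤ ∷ aᵥ ∷ a⁺ᵥ ∷ cᵥ ∷ c⁺ᵥ ∷ []) =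
    profile aᵤ a⁺ᵤ cᵤ c⁺ᵤ ∧ profile aᵥ a⁺ᵥ cᵥ c⁺ᵥ ∧ not (crosses aᵤ a⁺ᵤ aᵥ a⁺ᵥ) ⇒ᵇ
      toℕ (crosses (aᵤ ∧ not cᵤ) (aᵤ ∧ not cᵤ) (aᵥ ∧ not cᵥ) (aᵥ ∧ not cᵥ))
      + toℕ (crosses (not a⁺ᵤ ∧ not cᵤ) (not a⁺ᵤ ∧ not cᵤ) (not a⁺ᵥ ∧ not cᵥ) (not a⁺ᵥ ∧ not cᵥ))
      ≤ᵇ toℕ (crosses cᵤ c⁺ᵤ cᵥ c⁺ᵥ) + 0

-- Cut nodes

module _ (f : Subset n → Subset n) (inflationary : ∀ p → p ⊆ f p) where

  private
    grows : ∀ {p x} → x ∈ f p ─ p → ∣ p ∣ < ∣ f p ∣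
    grows {p} x∈fp─p = p⊂q⇒∣p∣<∣q∣ (inflationary p , _ , p─q⊆p _ _ x∈fp─p , x∈p─q⇒x∉q x∈fp─p)

  -- The fuel n ∸ ∣ p ∣ bounds the number of strict enlargements of p.
  closure : (P : Subset n → Set) → (∀ {p} → P p → P (f p)) →
            ∀ {p} → P p → ∃ λ r → P r × p ⊆ r × f r ⊆ r
  closure P preserved {p} Pp = iterate n (m∸n≤m n ∣ p ∣) Pp
    where
    iterate : ∀ fuel {p} → n ∸ ∣ p ∣ ≤ fuel → P p → ∃ λ r → P r × p ⊆ r × f r ⊆ r
    iterate fuel {p} bound Pp with nonempty? (f p ─ p)
    ... | no  none = p , Pp , id , ⊆-of-─-empty none
    ... | yes (_ , x∈fp─p) with fuel | grows x∈fp─p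
    ...   | zero      | ∣p∣<∣fp∣ =
      contradiction (≤-trans (∣p∣≤n (f p)) (m∸n≡0⇒m≤n (n≤0⇒n≡0 bound))) (<⇒≱ ∣p∣<∣fp∣)
    ...   | suc fuel′ | ∣p∣<∣fp∣
      with r , Pr , fp⊆r , closed
             ← iterate fuel′ (s≤s⁻¹ (<-≤-trans (∸-monoʳ-< ∣p∣<∣fp∣ (∣p∣≤n (f p))) bound)) (preserved Pp)
      = r , Pr , fp⊆r ∘ inflationary p , closed

module _ (G : Graph n) (w : Fin n) where

  Adjacent : Fin n → Fin n → Set
  Adjacent a b = Any (λ e → e ≡ (a , b) ⊎ e ≡ (b , a)) G

  reach-avoids : ∀ {x y} → x ≢ w → ReachAvoid G w x y → y ≢ w
  reach-avoids x≢w here             = x≢w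
  reach-avoids _   (step _ _ _ b≢w) = b≢w

  reach-stays-inside : ∀ {𝔸 x y} → ¬ CoveredBy G 𝔸 → (∀ {i} → i ∈ ∂ 𝔸 → i ≡ w) →
                       x ∈ inner 𝔸 → ReachAvoid G w x y → y ∈ inner 𝔸
  reach-stays-inside _ _ x∈A here = x∈A
  reach-stays-inside {𝔸} uncovered ∂≡w x∈A (step {a = a} {b} a-reached ab∈G refl b≢w)
    with b ∈? inner 𝔸 | b ∈? outer 𝔸
  ... | yes b∈A | _        = b∈A
  ... | no  b∉A | yes b∈A⁺ = contradiction (∂≡w (∈∂⁺ b∈A⁺ b∉A)) b≢w
  ... | no  b∉A | no  b∉A⁺ = contradiction (Any.map crossing ab∈G) uncovered
    where
    a∈A : a ∈ inner 𝔸
    a∈A = reach-stays-inside uncovered ∂≡w x∈A a-reached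
    crossing : ∀ {e} → e ≡ (a , b) ⊎ e ≡ (b , a) → Covers e 𝔸
    crossing (inj₁ refl) = inj₁ (a∈A , x∉p⇒x∈∁p b∉A⁺)
    crossing (inj₂ refl) = inj₂ (a∈A , x∉p⇒x∈∁p b∉A⁺)

  uncovered⇒cut-node : ∀ {𝔸} → Proper 𝔸 → w ∈ ∂ 𝔸 → (∀ {i} → i ∈ ∂ 𝔸 → i ≡ w) →
                       ¬ CoveredBy G 𝔸 → CutNode G w
  uncovered⇒cut-node (A⊆A⁺ , (x , x∈A) , (y , y∈A*)) w∈∂ ∂≡w uncovered =
    x , y , x≢w , y≢w , λ x⇝y → x∈∁p⇒x∉p y∈A* (A⊆A⁺ (reach-stays-inside uncovered ∂≡w x∈A x⇝y))
    where
    x≢w : x ≢ w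
    x≢w refl = proj₂ (∈∂⁻ w∈∂) x∈A
    y≢w : y ≢ w
    y≢w refl = x∈∁p⇒x∉p y∈A* (proj₁ (∈∂⁻ w∈∂))

  Extends : Subset n → Fin n → Set
  Extends R b = b ∈ R ⊎ (b ≢ w × ∃ λ a → a ∈ R × Adjacent a b)

  extends? : ∀ R b → Dec (Extends R b)
  extends? R b = (b ∈? R) ⊎-dec (¬? (b Fin.≟ w) ×-dec Fin.any? λ a → (a ∈? R) ×-dec adjacent? a)
    where
    _≟ₑ_ : (e e′ : Edge n) → Dec (e ≡ e′)
    _≟ₑ_ = ≡-dec Fin._≟_ Fin._≟_
    adjacent? : ∀ a → Dec (Adjacent a b)
    adjacent? a = Any.any? (λ e → (e ≟ₑ (a , b)) ⊎-dec (e ≟ₑ (b , a))) G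

  expand : Subset n → Subset n
  expand R = tabulate (does ∘ extends? R)

  expand-inflationary : ∀ R → R ⊆ expand R
  expand-inflationary R = ∈-tabulate⁺ (extends? R) ∘ inj₁

  Reached : Fin n → Subset n → Set
  Reached x R = ∀ {b} → b ∈ R → ReachAvoid G w x b

  expand-reached : ∀ {x R} → Reached x R → Reached x (expand R)
  expand-reached {R = R} reached b∈expand with ∈-tabulate⁻ (extends? R) b∈expand
  ... | inj₁ b∈R                    = reached b∈R
  ... | inj₂ (b≢w , a , a∈R , ab∈G) = step (reached a∈R) ab∈G refl b≢w

  closed⇒¬adjacent : ∀ {R a b} → expand R ⊆ R → a ∈ R → b ∈ ∁ (R ∪ ⁅ w ⁆) → ¬ Adjacent a b
  closed⇒¬adjacent {R} {a} {b} closed a∈R b∉R∪w ab∈G =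
    x∈∁p⇒x∉p b∉R∪w (p⊆p∪q ⁅ w ⁆ (closed (∈-tabulate⁺ (extends? R) (inj₂ (b≢w , a , a∈R , ab∈G)))))
    where
    b≢w : b ≢ w
    b≢w refl = x∈∁p⇒x∉p b∉R∪w (q⊆p∪q R ⁅ w ⁆ (x∈⁅x⁆ w))

  closed⇒uncovered : ∀ {R} → expand R ⊆ R → ¬ CoveredBy G (R , R ∪ ⁅ w ⁆)
  closed⇒uncovered closed covered with find covered
  ... | _ , uv∈G , inj₁ (u∈R , v∉R∪w) = closed⇒¬adjacent closed u∈R v∉R∪w (Any.map (inj₁ ∘ sym) uv∈G)
  ... | _ , uv∈G , inj₂ (v∈R , u∉R∪w) = closed⇒¬adjacent closed v∈R u∉R∪w (Any.map (inj₂ ∘ sym) uv∈G)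

  cut-node⇒uncovered : CutNode G w → ∃ λ 𝔹 → Proper 𝔹 × ∂ 𝔹 ≡ ⁅ w ⁆ × ¬ CoveredBy G 𝔹
  cut-node⇒uncovered (x , y , x≢w , y≢w , ¬x⇝y)
    with R , reached , ⁅x⁆⊆R , closed
           ← closure expand expand-inflationary (Reached x) expand-reached
               {⁅ x ⁆} (λ b∈⁅x⁆ → subst (ReachAvoid G w x) (sym (x∈⁅y⁆⇒x≡y x b∈⁅x⁆)) here)
    = (R , R ∪ ⁅ w ⁆) , proper , ∂≡⁅w⁆ , closed⇒uncovered closed
    where
    w∉R : w ∉ R
    w∉R w∈R = reach-avoids x≢w (reached w∈R) refl
    proper : Proper (R , R ∪ ⁅ w ⁆)
    proper = p⊆p∪q ⁅ w ⁆ , (x , ⁅x⁆⊆R (x∈⁅x⁆ x)) ,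
             (y , x∉p⇒x∈∁p ([ ¬x⇝y ∘ reached , y≢w ∘ x∈⁅y⁆⇒x≡y w ] ∘ x∈p∪q⁻ R ⁅ w ⁆))
    ∂≡⁅w⁆ : ∂ (R , R ∪ ⁅ w ⁆) ≡ ⁅ w ⁆
    ∂≡⁅w⁆ = ⊆-antisym
      (λ i∈∂ → let i∈R∪w , i∉R = ∈∂⁻ i∈∂ in [ flip contradiction i∉R , id ] (x∈p∪q⁻ R ⁅ w ⁆ i∈R∪w))
      (λ i∈⁅w⁆ → subst (_∈ ∂ (R , R ∪ ⁅ w ⁆)) (sym (x∈⁅y⁆⇒x≡y w i∈⁅w⁆)) (∈∂⁺ (q⊆p∪q R ⁅ w ⁆ (x∈⁅x⁆ w)) w∉R))

-- Tight bisets

module TightBisets (k : ℕ) (G₀ : Graph n) (Q : Subset n) where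

  -- `Tight k G₀ Q 𝔸` unfolds to `Proper 𝔸 × cap 𝔸 ≡ fin (k ∸ 1)`.
  cap : Biset n → ℕ∞
  cap 𝔸 = fin (deg G₀ 𝔸) +∞ qSum k Q (∂ 𝔸)

  cap-∂-empty : ∀ {𝔸} → ¬ Nonempty (∂ 𝔸) → cap 𝔸 ≡ fin (deg G₀ 𝔸)
  cap-∂-empty {𝔸} ∂-empty = trans (cong (fin (deg G₀ 𝔸) +∞_) (qSum-empty k Q ∂-empty)) (+∞-identityʳ _)

  cap-lower-bound : EdgeConnected (k ∸ 1) G₀ → ∀ {𝔸} → Proper 𝔸 → fin (k ∸ 1) ≤∞ cap 𝔸
  cap-lower-bound ec {A , A⁺} (A⊆A⁺ , (x , x∈A) , (y , y∈A*)) with nonempty? (∂ (A , A⁺))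
  ... | yes (v , v∈∂) = ≤∞-trans (k∸1≤∞q k Q v) (≤∞-trans (q≤∞qSum k Q v∈∂) (y≤∞x+∞y _ _))
  ... | no  ∂-empty   = subst (fin (k ∸ 1) ≤∞_) (sym (cap-∂-empty ∂-empty)) (fin≤fin
    (subst (λ B → k ∸ 1 ≤ deg G₀ (A , B)) (sym A⁺≡A) (ec A (x , x∈A) (y , subst (λ B → y ∈ ∁ B) A⁺≡A y∈A*))))
    where
    A⁺≡A : A⁺ ≡ A
    A⁺≡A = outer≡inner A⊆A⁺ ∂-empty

  cap-submodular : ∀ {𝔸 𝔹} → IsBiset 𝔸 → IsBiset 𝔹 → cap (𝔸 ∩ᵇ 𝔹) +∞ cap (𝔸 ∪ᵇ 𝔹) ≤∞ cap 𝔸 +∞ cap 𝔹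
  cap-submodular {𝔸} {𝔹} 𝔸-biset 𝔹-biset =
    subst₂ _≤∞_ (+∞-interchange _ _ _ _) (+∞-interchange _ _ _ _)
      (+∞-mono-≤∞ (fin≤fin (deg-mono₂ G₀ λ {e} _ → covers-submodular 𝔸-biset 𝔹-biset e))
                  (qSum-submodular k Q {∂ (𝔸 ∩ᵇ 𝔹)} {∂ (𝔸 ∪ᵇ 𝔹)} {∂ 𝔸} {∂ 𝔹} (∂-submodular 𝔸-biset 𝔹-biset)))

  tight-intersecting : EdgeConnected (k ∸ 1) G₀ → ∀ s → Intersecting (λ 𝔸 → Tight k G₀ Q 𝔸 × s ∈ star 𝔸)
  tight-intersecting ec s (A , A⁺) (B , B⁺) (((A⊆A⁺ , _) , capA) , s∈A*) (((B⊆B⁺ , _) , capB) , s∈B*)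
                     (x , x∈A∩B) = ((∩-proper , proj₁ caps) , s∉A⁺∩B⁺) , ((∪-proper , proj₂ caps) , s∉A⁺∪B⁺)
    where
    s∉A⁺∩B⁺ : s ∈ ∁ (A⁺ ∩ B⁺)
    s∉A⁺∩B⁺ = x∉p⇒x∈∁p (x∈∁p⇒x∉p s∈A* ∘ proj₁ ∘ x∈p∩q⁻ A⁺ B⁺)
    s∉A⁺∪B⁺ : s ∈ ∁ (A⁺ ∪ B⁺)
    s∉A⁺∪B⁺ = x∉p⇒x∈∁p ([ x∈∁p⇒x∉p s∈A* , x∈∁p⇒x∉p s∈B* ] ∘ x∈p∪q⁻ A⁺ B⁺)
    ∩-proper : Proper (A ∩ B , A⁺ ∩ B⁺)
    ∩-proper = (λ i∈A∩B → let i∈A , i∈B = x∈p∩q⁻ A B i∈A∩B in x∈p∩q⁺ (A⊆A⁺ i∈A , B⊆B⁺ i∈B)) ,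
               (x , x∈A∩B) , (s , s∉A⁺∩B⁺)
    ∪-proper : Proper (A ∪ B , A⁺ ∪ B⁺)
    ∪-proper = (λ i∈A∪B → [ p⊆p∪q B⁺ ∘ A⊆A⁺ , q⊆p∪q A⁺ B⁺ ∘ B⊆B⁺ ] (x∈p∪q⁻ A B i∈A∪B)) ,
               (x , p⊆p∪q B (proj₁ (x∈p∩q⁻ A B x∈A∩B))) , (s , s∉A⁺∪B⁺)
    caps : cap (A ∩ B , A⁺ ∩ B⁺) ≡ fin (k ∸ 1) × cap (A ∪ B , A⁺ ∪ B⁺) ≡ fin (k ∸ 1)
    caps = squeeze (subst₂ (λ a b → cap (A ∩ B , A⁺ ∩ B⁺) +∞ cap (A ∪ B , A⁺ ∪ B⁺) ≤∞ a +∞ b) capA capB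
                           (cap-submodular A⊆A⁺ B⊆B⁺))
                   (cap-lower-bound ec ∩-proper) (cap-lower-bound ec ∪-proper)

  tight⇒qSum≤∞ : ∀ {𝔸} → Tight k G₀ Q 𝔸 → qSum k Q (∂ 𝔸) ≤∞ fin (k ∸ 1)
  tight⇒qSum≤∞ {𝔸} (_ , cap≡) with qSum k Q (∂ 𝔸) | cap≡
  ... | fin b | cap≡′ = fin≤fin (subst (b ≤_) (fin-injective cap≡′) (m≤n+m b (deg G₀ 𝔸)))

  tight-∂-empty : ∀ {𝔸} → Tight k G₀ Q 𝔸 → ¬ Nonempty (∂ 𝔸) → deg G₀ 𝔸 ≡ k ∸ 1
  tight-∂-empty (_ , cap≡) ∂-empty = fin-injective (trans (sym (cap-∂-empty ∂-empty)) cap≡)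

  tight-∂⇒deg≡0 : ∀ {𝔸 v} → Tight k G₀ Q 𝔸 → v ∈ ∂ 𝔸 → deg G₀ 𝔸 ≡ 0
  tight-∂⇒deg≡0 {𝔸} {v} (_ , cap≡) v∈∂
    with qSum k Q (∂ 𝔸) | cap≡ | ≤∞-trans (k∸1≤∞q k Q v) (q≤∞qSum k Q v∈∂)
  ... | fin b | cap≡′ | fin≤fin k∸1≤b =
    n≤0⇒n≡0 (+-cancelʳ-≤ b _ 0 (subst (_≤ b) (sym (fin-injective cap≡′)) k∸1≤b))

  tight-∂⊆Q : ∀ {𝔸 v} → Tight k G₀ Q 𝔸 → v ∈ ∂ 𝔸 → v ∈ Q
  tight-∂⊆Q {v = v} tight v∈∂ with v ∈? Q
  ... | yes v∈Q = v∈Q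
  ... | no  v∉Q with () ← ≤∞-trans (subst (_≤∞ _) (q-∉ k Q v∉Q) (q≤∞qSum k Q v∈∂)) (tight⇒qSum≤∞ tight)

  tight-∂-unique : 2 ≤ k → ∀ {𝔸 v w} → Tight k G₀ Q 𝔸 → v ∈ ∂ 𝔸 → w ∈ ∂ 𝔸 → v ≡ w
  tight-∂-unique 2≤k {v = v} {w} tight v∈∂ w∈∂ with v Fin.≟ w
  ... | yes v≡w = v≡w
  ... | no  v≢w
    with ≤∞-trans (≤∞-trans (+∞-mono-≤∞ (k∸1≤∞q k Q v) (k∸1≤∞q k Q w)) (q+q≤∞qSum k Q v≢w v∈∂ w∈∂))
                  (tight⇒qSum≤∞ tight)
  ... | fin≤fin 2[k∸1]≤k∸1 = contradiction 2[k∸1]≤k∸1 (m+m≰m (0<k∸1 2≤k))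

  tight-co : ∀ {𝔸} → Tight k G₀ Q 𝔸 → Tight k G₀ Q (co 𝔸)
  tight-co {A , A⁺} ((A⊆A⁺ , (x , x∈A) , A*-nonempty) , cap≡) =
    (p⊆q⇒∁p⊇∁q A⊆A⁺ , A*-nonempty , (x , ∈-star-co {𝔸 = A , A⁺} x∈A)) ,
    trans (cong₂ (λ d S → fin d +∞ qSum k Q S) (deg-co G₀ (A , A⁺)) (∂-co (A , A⁺))) cap≡

  isolated-biset-tight : ∀ {𝔸 v} → Proper 𝔸 → ∂ 𝔸 ≡ ⁅ v ⁆ → v ∈ Q → deg G₀ 𝔸 ≡ 0 → Tight k G₀ Q 𝔸
  isolated-biset-tight {𝔸} {v} proper ∂≡⁅v⁆ v∈Q deg≡0 = proper , (begin
    fin (deg G₀ 𝔸) +∞ qSum k Q (∂ 𝔸) ≡⟨ cong₂ (λ d S → fin d +∞ qSum k Q S) deg≡0 ∂≡⁅v⁆ ⟩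
    fin 0 +∞ qSum k Q ⁅ v ⁆          ≡⟨ +∞-identityˡ _ ⟩
    qSum k Q ⁅ v ⁆                   ≡⟨ qSum-⁅⁆ k Q v ⟩
    q k Q v                          ≡⟨ q-∈ k Q v∈Q ⟩
    fin (k ∸ 1)                      ∎)
    where open ≡-Reasoning

  module _ (2≤k : 2 ≤ k) (ec : EdgeConnected (k ∸ 1) G₀) where

    covers-tight⇒k-connected : ∀ J → CoversFamily J (Tight k G₀ Q) → EdgeConnected k (G₀ ++ J)
    covers-tight⇒k-connected J cover S S-nonempty ∁S-nonempty with k ≤? deg G₀ (S , S)
    ... | yes k≤d = ≤-trans k≤d (subst (deg G₀ (S , S) ≤_) (sym (deg-++ G₀ J (S , S))) (m≤m+n _ _))
    ... | no  k≰d = begin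
      k                                ≡⟨ m∸n+n≡m (≤-trans (s≤s z≤n) 2≤k) ⟨
      (k ∸ 1) + 1                      ≡⟨ cong (_+ 1) d≡k∸1 ⟨
      deg G₀ (S , S) + 1               ≤⟨ +-monoʳ-≤ (deg G₀ (S , S)) (covered⇒0<deg (cover (S , S) tight)) ⟩
      deg G₀ (S , S) + deg J (S , S)   ≡⟨ deg-++ G₀ J (S , S) ⟨
      deg (G₀ ++ J) (S , S)            ∎
      where
      open ≤-Reasoning
      d≡k∸1 : deg G₀ (S , S) ≡ k ∸ 1
      d≡k∸1 = ≤-antisym (<⇒≤pred (≰⇒> k≰d)) (ec S S-nonempty ∁S-nonempty)
      tight : Tight k G₀ Q (S , S)
      tight = (id , S-nonempty , ∁S-nonempty) ,
              trans (cap-∂-empty λ (i , i∈S─S) → x∈p─q⇒x∉q i∈S─S (p─q⊆p S S i∈S─S)) (cong fin d≡k∸1)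

    covers-tight⇒no-cut-node : ∀ J → CoversFamily J (Tight k G₀ Q) → ∀ v → v ∈ Q → ¬ CutNode (G₀ ++ J) v
    covers-tight⇒no-cut-node J cover v v∈Q cut
      with 𝔹 , proper , ∂≡⁅v⁆ , uncovered ← cut-node⇒uncovered (G₀ ++ J) v cut
      = uncovered (++⁺ʳ G₀ (cover 𝔹 (isolated-biset-tight proper ∂≡⁅v⁆ v∈Q
                                       (uncovered⇒deg≡0 G₀ 𝔹 (uncovered ∘ ++⁺ˡ)))))

    k-connected⇒covers-tight : ∀ J → EdgeConnected k (G₀ ++ J) →
      ∀ {𝔸} → Tight k G₀ Q 𝔸 → ¬ Nonempty (∂ 𝔸) → CoveredBy J 𝔸
    k-connected⇒covers-tight J ec-k {A , A⁺} tight@((A⊆A⁺ , A-nonempty , (y , y∈A*)) , _) ∂-empty =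
      0<deg⇒covered J (A , A⁺) (+-cancelˡ-≤ (k ∸ 1) 1 _ (begin
        (k ∸ 1) + 1                      ≡⟨ m∸n+n≡m (≤-trans (s≤s z≤n) 2≤k) ⟩
        k                                ≤⟨ subst (λ B → k ≤ deg (G₀ ++ J) (A , B)) (sym A⁺≡A)
                                             (ec-k A A-nonempty (y , subst (λ B → y ∈ ∁ B) A⁺≡A y∈A*)) ⟩
        deg (G₀ ++ J) (A , A⁺)           ≡⟨ deg-++ G₀ J (A , A⁺) ⟩
        deg G₀ (A , A⁺) + deg J (A , A⁺) ≡⟨ cong (_+ deg J (A , A⁺)) (tight-∂-empty tight ∂-empty) ⟩
        (k ∸ 1) + deg J (A , A⁺)         ∎))
      where
      open ≤-Reasoning
      A⁺≡A : A⁺ ≡ A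
      A⁺≡A = outer≡inner A⊆A⁺ ∂-empty

    no-cut-node⇒covers-tight : ∀ J → (∀ v → v ∈ Q → ¬ CutNode (G₀ ++ J) v) →
      ∀ {𝔸 v} → Tight k G₀ Q 𝔸 → v ∈ ∂ 𝔸 → CoveredBy J 𝔸
    no-cut-node⇒covers-tight J no-cut {𝔸} {v} tight v∈∂ with Any.any? (λ e → covers? e 𝔸) J
    ... | yes covered  = covered
    ... | no  ¬covered = contradiction
      (uncovered⇒cut-node (G₀ ++ J) v (proj₁ tight) v∈∂ (λ i∈∂ → tight-∂-unique 2≤k tight i∈∂ v∈∂)
        ([ deg≡0⇒uncovered (tight-∂⇒deg≡0 tight v∈∂) , ¬covered ] ∘ ++⁻ G₀))
      (no-cut v (tight-∂⊆Q tight v∈∂))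

    augmented⇔covers-tight : ∀ J → (EdgeConnected k (G₀ ++ J) × (∀ v → v ∈ Q → ¬ CutNode (G₀ ++ J) v))
                                   ⇔ CoversFamily J (Tight k G₀ Q)
    augmented⇔covers-tight J = mk⇔
      (λ (ec-k , no-cut) 𝔸 tight → covers-tight ec-k no-cut tight (nonempty? (∂ 𝔸)))
      (λ cover → covers-tight⇒k-connected J cover , covers-tight⇒no-cut-node J cover)
      where
      covers-tight : EdgeConnected k (G₀ ++ J) → (∀ v → v ∈ Q → ¬ CutNode (G₀ ++ J) v) →
                     ∀ {𝔸} → Tight k G₀ Q 𝔸 → Dec (Nonempty (∂ 𝔸)) → CoveredBy J 𝔸
      covers-tight _    no-cut tight (yes (v , v∈∂)) = no-cut-node⇒covers-tight J no-cut tight v∈∂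
      covers-tight ec-k _      tight (no  ∂-empty)   = k-connected⇒covers-tight J ec-k tight ∂-empty

    module _ {ℂ : Biset n} (core : Core (Tight k G₀ Q) ℂ) {s : Fin n} (s∈C : s ∈ inner ℂ) where

      private
        escape : Biset n → Subset n
        escape 𝔸 = inner 𝔸 ─ inner ℂ

        C⊆C⁺ : inner ℂ ⊆ outer ℂ
        C⊆C⁺ = proj₁ (proj₁ (proj₁ core))

      ∂-tight⊆core : ∀ {𝔸} → Tight k G₀ Q 𝔸 → s ∈ ∂ 𝔸 → ∂ 𝔸 ⊆ inner ℂ
      ∂-tight⊆core tight s∈∂ i∈∂ = subst (_∈ inner ℂ) (sym (tight-∂-unique 2≤k tight i∈∂ s∈∂)) s∈C

      escape-nonempty : ∀ {𝔸} → Tight k G₀ Q 𝔸 → s ∈ ∂ 𝔸 → Nonempty (escape 𝔸)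
      escape-nonempty {𝔸} tight s∈∂ with nonempty? (escape 𝔸)
      ... | yes nonempty = nonempty
      ... | no  empty    = contradiction (subst (λ 𝔹 → s ∈ inner 𝔹) (sym 𝔸≡ℂ) s∈C) (proj₂ (∈∂⁻ s∈∂))
        where
        A⁺⊆C⁺ : outer 𝔸 ⊆ outer ℂ
        A⁺⊆C⁺ {i} i∈A⁺ with i ∈? inner 𝔸
        ... | yes i∈A = C⊆C⁺ (⊆-of-─-empty empty i∈A)
        ... | no  i∉A = C⊆C⁺ (∂-tight⊆core tight s∈∂ (∈∂⁺ i∈A⁺ i∉A))
        𝔸≡ℂ : 𝔸 ≡ ℂ
        𝔸≡ℂ = proj₂ core 𝔸 tight (⊆-of-─-empty empty , A⁺⊆C⁺)

      k∸1≤deg-escape : ∀ {𝔸} → Tight k G₀ Q 𝔸 → s ∈ ∂ 𝔸 → k ∸ 1 ≤ deg G₀ (escape 𝔸 , escape 𝔸)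
      k∸1≤deg-escape tight s∈∂ =
        ec _ (escape-nonempty tight s∈∂) (s , x∉p⇒x∈∁p (proj₂ (∈∂⁻ s∈∂) ∘ p─q⊆p _ _))

      private
        uncovered : ∀ {𝔸 e} → Tight k G₀ Q 𝔸 → s ∈ ∂ 𝔸 → e ∈ₗ G₀ → covers 𝔸 e ≡ false
        uncovered tight s∈∂ = uncovered⇒¬covers (deg≡0⇒uncovered (tight-∂⇒deg≡0 tight s∈∂))

      deg-escape≤deg-core : ∀ {𝔸} → Tight k G₀ Q 𝔸 → s ∈ ∂ 𝔸 → ∂ ℂ ⊆ ∁ (inner 𝔸) →
                            deg G₀ (escape 𝔸 , escape 𝔸) ≤ deg G₀ ℂ
      deg-escape≤deg-core tight s∈∂ ∂C⊆A* = deg-mono G₀ λ {e} e∈G₀ →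
        covers-escape⇒covers (proj₁ (proj₁ tight)) (∂-tight⊆core tight s∈∂) ∂C⊆A* e
          (uncovered tight s∈∂ e∈G₀)

      deg-escapes≤deg-core : ∀ {𝔸} → Tight k G₀ Q 𝔸 → s ∈ ∂ 𝔸 → ¬ Nonempty (∂ ℂ) →
        deg G₀ (escape 𝔸 , escape 𝔸) + deg G₀ (escape (co 𝔸) , escape (co 𝔸)) ≤ deg G₀ ℂ + deg G₀ 𝔸
      deg-escapes≤deg-core tight s∈∂ ∂C-empty = deg-mono₂ G₀ λ {e} e∈G₀ →
        covers-escapes-≤ (proj₁ (proj₁ tight)) (∂-tight⊆core tight s∈∂)
          (⊆-reflexive (outer≡inner C⊆C⁺ ∂C-empty)) e (uncovered tight s∈∂ e∈G₀)

      ∂-core⊆inner : ∀ {𝔸} → Tight k G₀ Q 𝔸 → s ∈ ∂ 𝔸 → ∂ ℂ ⊆ inner 𝔸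
      ∂-core⊆inner {𝔸} tight s∈∂ {v} v∈∂C with v ∈? inner 𝔸
      ... | yes v∈A = v∈A
      ... | no  v∉A = contradiction (begin
        k ∸ 1                        ≤⟨ k∸1≤deg-escape tight s∈∂ ⟩
        deg G₀ (escape 𝔸 , escape 𝔸) ≤⟨ deg-escape≤deg-core tight s∈∂ ∂C⊆A* ⟩
        deg G₀ ℂ                     ≡⟨ tight-∂⇒deg≡0 (proj₁ core) v∈∂C ⟩
        0                            ∎) (<⇒≱ (0<k∸1 2≤k))
        where
        open ≤-Reasoning
        ∂C⊆A* : ∂ ℂ ⊆ ∁ (inner 𝔸)
        ∂C⊆A* i∈∂C = x∉p⇒x∈∁p (subst (_∉ inner 𝔸) (sym (tight-∂-unique 2≤k (proj₁ core) i∈∂C v∈∂C)) v∉A)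

      s∉∂-tight : ∀ {𝔸} → Tight k G₀ Q 𝔸 → s ∉ ∂ 𝔸
      s∉∂-tight {𝔸} tight s∈∂ with nonempty? (∂ ℂ)
      ... | yes (v , v∈∂C) =
        x∈∁p⇒x∉p (∂-core⊆inner (tight-co tight) (∈∂-co s∈∂) v∈∂C)
                 (proj₁ (proj₁ tight) (∂-core⊆inner tight s∈∂ v∈∂C))
      ... | no  ∂C-empty = m+m≰m (0<k∸1 2≤k) (begin
        (k ∸ 1) + (k ∸ 1)
          ≤⟨ +-mono-≤ (k∸1≤deg-escape tight s∈∂) (k∸1≤deg-escape (tight-co tight) (∈∂-co s∈∂)) ⟩
        deg G₀ (escape 𝔸 , escape 𝔸) + deg G₀ (escape (co 𝔸) , escape (co 𝔸))
          ≤⟨ deg-escapes≤deg-core tight s∈∂ ∂C-empty ⟩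
        deg G₀ ℂ + deg G₀ 𝔸
          ≡⟨ cong₂ _+_ (tight-∂-empty (proj₁ core) ∂C-empty) (tight-∂⇒deg≡0 tight s∈∂) ⟩
        (k ∸ 1) + 0
          ≡⟨ +-identityʳ (k ∸ 1) ⟩
        k ∸ 1 ∎)
        where open ≤-Reasoning

      covers-ℱ⇔covers-tight : ∀ J → CoversFamily J (λ 𝔸 → Tight k G₀ Q 𝔸 × s ∈ star 𝔸)
                                     ⇔ CoversFamily J (Tight k G₀ Q)
      covers-ℱ⇔covers-tight J = mk⇔ covers-tight (λ cover 𝔸 → cover 𝔸 ∘ proj₁)
        where
        covers-tight : CoversFamily J (λ 𝔸 → Tight k G₀ Q 𝔸 × s ∈ star 𝔸) → CoversFamily J (Tight k G₀ Q)
        covers-tight cover 𝔸 tight with s ∈? outer 𝔸 | s ∈? inner 𝔸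
        ... | no  s∉A⁺ | _       = cover 𝔸 (tight , x∉p⇒x∈∁p s∉A⁺)
        ... | yes _    | yes s∈A = Any.map (Equivalence.to (Covers-co _ 𝔸))
                                     (cover (co 𝔸) (tight-co tight , ∈-star-co {𝔸 = 𝔸} s∈A))
        ... | yes s∈A⁺ | no  s∉A = contradiction (∈∂⁺ s∈A⁺ s∉A) (s∉∂-tight tight)

lemma4 : (n k : ℕ) → 2 ≤ k → (G₀ : Graph n) → EdgeConnected (k ∸ 1) G₀ →
         (Q : Subset n) → (ℂ₀ : Biset n) → Core (Tight k G₀ Q) ℂ₀ →
         (s : Fin n) → s ∈ proj₁ ℂ₀ →
         Intersecting (λ 𝔸 → Tight k G₀ Q 𝔸 × s ∈ star 𝔸)
         × ((J : Graph n) →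
            ((EdgeConnected k (G₀ ++ J) × (∀ v → v ∈ Q → ¬ CutNode (G₀ ++ J) v))
             ⇔ CoversFamily J (λ 𝔸 → Tight k G₀ Q 𝔸 × s ∈ star 𝔸)))
lemma4 n k 2≤k G₀ ec Q ℂ₀ core s s∈C₀ =
  tight-intersecting ec s ,
  λ J → ⇔-sym (covers-ℱ⇔covers-tight 2≤k ec core s∈C₀ J) ⇔-∘ augmented⇔covers-tight 2≤k ec J
  where open TightBisets k G₀ Q
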